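{- Let $n\ge 2$, let $q$ be a power of a prime, let $M\in \mathsf{M}_n(\mathbb{F}_q)$ with $M\ne 0$, and let $1\le k\le n-1$. For $N\in \mathsf{M}_n(\mathbb{F}_q)$ write $N=\begin{pmatrix}p_{11}(N)&p_{12}(N)\\ p_{21}(N)&p_{22}(N)\end{pmatrix}$ in block form, where $p_{11}(N)$ is $k\times k$, $p_{12}(N)$ is $k\times(n-k)$, $p_{21}(N)$ is $(n-k)\times k$ and $p_{22}(N)$ is $(n-k)\times(n-k)$. Let $E=\{N\in \mathsf{M}_n(\mathbb{F}_q): p_{11}(N)=0,\ p_{21}(N)=0,\ p_{22}(N)=0\}$ and $1+E=\{I_n+N:N\in E\}$, an abelian subgroup of $\mathrm{GL}_n(\mathbb{F}_q)$. Writing $\mathbb{E}_{h\in 1+E}$ for the average over $h\in 1+E$, the following hold: (1) $\mathbb{E}_{h\in 1+E}\big(\mathbf{1}_{p_{11}(h^{ -1}Mh)=0}\big)\le q^{ -k}+\min_{h\in 1+E}\big(\mathbf{1}_{p_{11}(h^{ -1}Mh)=0 \text{ and } p_{21}(h^{ -1}Mh)=0}\big)$; (2) $\mathbb{E}_{h\in 1+E}\big(\mathbf{1}_{p_{11}(h^{ -1}Mh)=0\text{ and }p_{22}(h^{ -1}Mh)=0}\big)\le q^{ -(n-1)}+\min_{h\in 1+E}\big(\mathbf{1}_{p_{11}(h^{ -1}Mh)=p_{21}(h^{ -1}Mh)=p_{22}(h^{ -1}Mh)=0}\big)$; (3) $\mathbb{E}_{h\in 1+E}\big(\mathbf{1}_{p_{11}(h^{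 -1}Mh)=p_{12}(h^{ -1}Mh)=p_{22}(h^{ -1}Mh)=0}\big)\le q^{ -(n-1)}$.
   Context: $\mathbf{1}_{P}$ equals $1$ if the condition $P$ holds and $0$ otherwise. -}

module Defs where

open import Level using (Level; 0ℓ)
open import Data.Nat as ℕ using (ℕ; zero; suc; _^_)
open import Data.Nat.Primality using (Prime)
open import Data.Fin using (Fin; zero; suc; _↑ˡ_; _↑ʳ_; splitAt)
open import Data.Sum using (inj₁; inj₂)
open import Data.Fin.Properties using (all?)
open import Data.List using (List; []; _∷_; length; filter; concatMap; map)
open import Data.List.Relation.Unary.All using (All)
import Data.List.Relation.Unary.All as All
open import Data.List.Membership.Propositional using (_∈_)
open import Data.List.Relation.Unary.Unique.Propositional using (Unique)
open import Data.Product using (Σ; _×_; ∃; ∃-syntax)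
open import Data.Bool using (Bool; true; false; if_then_else_)
open import Data.Integer using (+_)
open import Data.Rational using (ℚ; _/_; 0ℚ; 1ℚ)
open import Relation.Binary.PropositionalEquality using (_≡_)
open import Relation.Binary.Definitions using (DecidableEquality)
open import Relation.Nullary using (¬_; Dec; yes; no; _×-dec_)
open import Relation.Nullary.Decidable using (⌊_⌋)
open import Algebra.Structures using (IsCommutativeRing)

IsPrimePower : ℕ → Set
IsPrimePower q = ∃[ p ] ∃[ e ] (Prime p × (1 ℕ.≤ e) × q ≡ p ^ e)

record FiniteField : Set₁ where
  field
    Carrier  : Set
    _+_ _*_  : Carrier → Carrier → Carrier
    -_       : Carrier → Carrier
    0# 1#    : Carrier
    isCommutativeRing : IsCommutativeRing _≡_ _+_ _*_ -_ 0# 1#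
    0≢1      : ¬ (0# ≡ 1#)
    inverse  : ∀ x → ¬ (x ≡ 0#) → ∃[ y ] (x * y ≡ 1#)
    _≟_      : DecidableEquality Carrier
    elements : List Carrier
    complete : ∀ x → x ∈ elements
    unique   : Unique elements

  card : ℕ
  card = length elements

allFuns : ∀ {A : Set} → List A → (n : ℕ) → List (Fin n → A)
allFuns xs zero    = (λ ()) ∷ []
allFuns xs (suc n) = concatMap (λ x → map (λ f → cons x f) (allFuns xs n)) xs
  where
  cons : ∀ {A : Set} {n} → A → (Fin n → A) → Fin (suc n) → A
  cons x f zero    = x
  cons x f (suc i) = f i

-- a / d as a rational (d = 0 gives 0, never used)
frac : ℕ → ℕ → ℚ
frac a zero    = 0ℚ
frac a (suc d) = (+ a) / suc d

𝔼 : ∀ {A : Set} (xs : List A) {P : A → Set} → (∀ x → Dec (P x)) → ℚ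
𝔼 xs P? = frac (length (filter P? xs)) (length xs)

-- minimum over a (nonempty) list of the indicator of a decidable predicate
minInd : ∀ {A : Set} (xs : List A) {P : A → Set} → (∀ x → Dec (P x)) → ℚ
minInd xs P? = if ⌊ All.all? P? xs ⌋ then 1ℚ else 0ℚ

module Matrices (F : FiniteField) where
  open FiniteField F

  Mat : ℕ → Set
  Mat n = Fin n → Fin n → Carrier

  sumF : ∀ {n} → (Fin n → Carrier) → Carrier
  sumF {zero}  f = 0#
  sumF {suc n} f = f zero + sumF (λ i → f (suc i))

  _⊗_ : ∀ {n} → Mat n → Mat n → Mat n
  (A ⊗ B) i j = sumF (λ l → A i l * B l j)

  𝟙 : ∀ {n} → Mat n
  𝟙 i j with i Data.Fin.≟ j
  ... | yes _ = 1#
  ... | no  _ = 0#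

  𝟘 : ∀ {n} → Mat n
  𝟘 i j = 0#

  -- Block decomposition of an n×n matrix with n = k + m:
  -- rows/columns 1..k are indexed by (i ↑ˡ m), the rest by (k ↑ʳ j).
  module Blocks (k m : ℕ) where
    p₁₁ : Mat (k ℕ.+ m) → Fin k → Fin k → Carrier
    p₁₁ N i j = N (i ↑ˡ m) (j ↑ˡ m)
    p₁₂ : Mat (k ℕ.+ m) → Fin k → Fin m → Carrier
    p₁₂ N i j = N (i ↑ˡ m) (k ↑ʳ j)
    p₂₁ : Mat (k ℕ.+ m) → Fin m → Fin k → Carrier
    p₂₁ N i j = N (k ↑ʳ i) (j ↑ˡ m)
    p₂₂ : Mat (k ℕ.+ m) → Fin m → Fin m → Carrier
    p₂₂ N i j = N (k ↑ʳ i) (k ↑ʳ j)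

    isZero : ∀ {a b} (B : Fin a → Fin b → Carrier) → Dec (∀ i j → B i j ≡ 0#)
    isZero B = all? (λ i → all? (λ j → B i j ≟ 0#))

    -- E = matrices whose only nonzero block is p₁₂; given by its p₁₂ block X
    embedE : (Fin k → Fin m → Carrier) → Mat (k ℕ.+ m)
    embedE X r c with splitAt k r | splitAt k c
    ... | inj₁ i | inj₂ j = X i j
    ... | _      | _      = 0#

    -- h = I + N  (N ∈ E)  and its inverse h⁻¹ = I - N  (since N² = 0)
    hOf : (Fin k → Fin m → Carrier) → Mat (k ℕ.+ m)
    hOf X i j = 𝟙 i j + embedE X i j

    hInvOf : (Fin k → Fin m → Carrier) → Mat (k ℕ.+ m)
    hInvOf X i j = 𝟙 i j + (- embedE X i j)

    conj : Mat (k ℕ.+ m) → (Fin k → Fin m → Carrier) → Mat (k ℕ.+ m)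
    conj M X = (hInvOf X ⊗ M) ⊗ hOf X

    -- all k×m matrices over the field, i.e. a parametrisation of 1+E
    allBlocks : List (Fin k → Fin m → Carrier)
    allBlocks = allFuns (allFuns elements m) k

module Submission where

-- Write M = [[A, B], [C, D]] and h = 1 + [[0, X], [0, 0]], so that
-- h⁻¹ M h = [[A - XC, B - XD + (A - XC) X], [C, D + CX]].
-- If C = 0, the blocks p₁₁, p₂₁, p₂₂ of h⁻¹ M h do not depend on h, so each
-- event holds for all h or for none; in (3) it would moreover force M = 0.
-- If C a b ≠ 0, then on the event p₁₁ = 0, i.e. XC = A, column a of X is
-- determined by the other columns, and on p₁₁ = p₂₂ = 0 also CX = -D, which
-- determines row b as well.  So the good X inject into the q^(k(m-1)), resp.
-- q^((k-1)(m-1)), choices of the remaining entries, out of q^(km).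

open import Level using (0ℓ)
open import Data.Nat as ℕ using (ℕ; zero; suc; _^_; z≤n; s≤s)
import Data.Nat.Properties as ℕ
open import Data.Nat.Tactic.RingSolver using (solve-∀)
import Data.Integer as ℤ
import Data.Integer.Properties as ℤ
open import Data.Rational using (0ℚ; 1ℚ) renaming (_≤_ to _≤ℚ_; _+_ to _+ℚ_)
import Data.Rational.Properties as ℚ
import Data.Rational.Unnormalised as ℚᵘ
import Data.Rational.Unnormalised.Properties as ℚᵘ
open import Data.Fin as Fin using (Fin; zero; suc; _↑ˡ_; _↑ʳ_; splitAt; join; punchIn; punchOut)
open import Data.Fin.Properties
  using (all?; ¬∀⟶∃¬; injective⇒≤; splitAt-↑ˡ; splitAt-↑ʳ; join-splitAt; punchInᵢ≢i; punchIn-punchOut)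
open import Data.List
  using (List; []; _∷_; _++_; length; lookup; map; filter; concatMap; cartesianProductWith)
open import Data.List.Properties using (length-++; length-map; length-filter; filter-none)
open import Data.List.Relation.Unary.All as All using (All)
open import Data.List.Relation.Unary.All.Properties using (all-filter)
open import Data.List.Relation.Unary.AllPairs as AllPairs using (_∷_)
open import Data.List.Relation.Unary.Any as Any using (here)
open import Data.List.Relation.Unary.Any.Properties using (lookup-index)
open import Data.List.Membership.Propositional.Properties using (∈-lookup; ∈-length)
import Data.List.Membership.Setoid as SetoidMembership
open import Data.List.Membership.Setoid.Properties using (∈-cartesianProductWith⁺; ∈-resp-≈)
open import Data.List.Relation.Unary.Unique.Setoid using (Unique)
open import Data.List.Relation.Unary.Unique.Setoid.Properties using (cartesianProductWith⁺; filter⁺)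
open import Data.List.Relation.Unary.Enumerates.Setoid using (IsEnumeration)
import Data.Vec.Functional.Relation.Binary.Pointwise.Properties as Pointwise
open import Data.Product using (_,_; _×_; ∃₂)
open import Data.Sum using (inj₁; inj₂)
open import Data.Empty using (⊥-elim)
open import Function using (_∘_)
open import Relation.Binary.Bundles using (Setoid)
open import Relation.Binary.PropositionalEquality as ≡ using (_≡_; _≢_; refl)
open import Relation.Nullary using (Dec; yes; no; ¬_; _×-dec_)
open import Relation.Unary using (Pred)
open import Algebra.Bundles using (CommutativeRing)
import Algebra.Properties.Ring as RingProperties
import Algebra.Properties.CommutativeMonoid.Sum as MonoidSum
import Algebra.Properties.CommutativeSemigroup as CommutativeSemigroupProperties
open import Defs

module _ {a ℓ} (S : Setoid a ℓ) where
  open Setoid S using (_≈_; sym)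

  Unique-lookup-injective : ∀ {xs} → Unique S xs → ∀ {i j} → lookup xs i ≈ lookup xs j → i ≡ j
  Unique-lookup-injective (x≉xs ∷ xs!) {zero}  {zero}  _  = refl
  Unique-lookup-injective (x≉xs ∷ xs!) {zero}  {suc j} eq = ⊥-elim (All.lookup x≉xs (∈-lookup j) eq)
  Unique-lookup-injective (x≉xs ∷ xs!) {suc i} {zero}  eq = ⊥-elim (All.lookup x≉xs (∈-lookup i) (sym eq))
  Unique-lookup-injective (x≉xs ∷ xs!) {suc i} {suc j} eq = ≡.cong suc (Unique-lookup-injective xs! eq)

module _ {a b ℓ₁ ℓ₂} (S : Setoid a ℓ₁) (T : Setoid b ℓ₂) where
  open Setoid S using () renaming (Carrier to A; _≈_ to _≈₁_)
  open Setoid T using ()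
    renaming (Carrier to B; _≈_ to _≈₂_; reflexive to reflexive₂; sym to sym₂; trans to trans₂)

  injectiveOn⇒length≤ : ∀ {p} {P : Pred A p} (r : A → B) → (∀ {x y} → P x → P y → r x ≈₂ r y → x ≈₁ y) →
    ∀ {xs ys} → Unique S xs → All P xs → IsEnumeration T ys → length xs ℕ.≤ length ys
  injectiveOn⇒length≤ r r-injective {xs} {ys} xs! Pxs _∈ys = injective⇒≤ position-injective
    where
    position : Fin (length xs) → Fin (length ys)
    position i = Any.index (r (lookup xs i) ∈ys)

    r-lookup : ∀ i → r (lookup xs i) ≈₂ lookup ys (position i)
    r-lookup i = lookup-index (r (lookup xs i) ∈ys)

    position-injective : ∀ {i j} → position i ≡ position j → i ≡ j
    position-injective {i} {j} eq = Unique-lookup-injective S xs!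
      (r-injective (All.lookup Pxs (∈-lookup i)) (All.lookup Pxs (∈-lookup j))
        (trans₂ (r-lookup i) (trans₂ (reflexive₂ (≡.cong (lookup ys) eq)) (sym₂ (r-lookup j)))))

-- allFuns xs (suc n) unfolds to the left-hand side, with f the anonymous cons of
-- its where-block; below, that f is passed as _ and found by unification.
concatMap≡cartesianProductWith : ∀ {A B C : Set} (f : A → B → C) xs ys →
  concatMap (λ x → map (f x) ys) xs ≡ cartesianProductWith f xs ys
concatMap≡cartesianProductWith f []       ys = refl
concatMap≡cartesianProductWith f (x ∷ xs) ys =
  ≡.cong (map (f x) ys ++_) (concatMap≡cartesianProductWith f xs ys)

length-cartesianProductWith : ∀ {A B C : Set} (f : A → B → C) xs ys →
  length (cartesianProductWith f xs ys) ≡ length xs ℕ.* length ys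
length-cartesianProductWith f []       ys = refl
length-cartesianProductWith f (x ∷ xs) ys = begin
  length (map (f x) ys ++ cartesianProductWith f xs ys)
    ≡⟨ length-++ (map (f x) ys) ⟩
  length (map (f x) ys) ℕ.+ length (cartesianProductWith f xs ys)
    ≡⟨ ≡.cong₂ ℕ._+_ (length-map (f x) ys) (length-cartesianProductWith f xs ys) ⟩
  length ys ℕ.+ length xs ℕ.* length ys
    ∎
  where open ≡.≡-Reasoning

length-allFuns : ∀ {A : Set} (xs : List A) n → length (allFuns xs n) ≡ length xs ^ n
length-allFuns xs zero    = refl
length-allFuns xs (suc n) = begin
  length (allFuns xs (suc n))                        ≡⟨ ≡.cong length (concatMap≡cartesianProductWith _ xs _) ⟩
  length (cartesianProductWith _ xs (allFuns xs n))  ≡⟨ length-cartesianProductWith _ xs _ ⟩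
  length xs ℕ.* length (allFuns xs n)                ≡⟨ ≡.cong (length xs ℕ.*_) (length-allFuns xs n) ⟩
  length xs ^ suc n                                  ∎
  where open ≡.≡-Reasoning

module _ {ℓ} (S : Setoid 0ℓ ℓ) where
  open Setoid S using (_≈_) renaming (refl to ≈-refl)
  open SetoidMembership using (_∈_)

  allFuns-unique : ∀ {xs} → Unique S xs → ∀ n → Unique (Pointwise.setoid S n) (allFuns xs n)
  allFuns-unique xs! zero    = All.[] ∷ AllPairs.[]
  allFuns-unique {xs} xs! (suc n) =
    ≡.subst (Unique (Pointwise.setoid S (suc n))) (≡.sym (concatMap≡cartesianProductWith _ xs _))
      (cartesianProductWith⁺ S (Pointwise.setoid S n) (Pointwise.setoid S (suc n)) _
        (λ eq → eq zero , λ i → eq (suc i)) xs! (allFuns-unique xs! n))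

  allFuns-enumerates : ∀ {xs} → IsEnumeration S xs →
    ∀ n → IsEnumeration (Pointwise.setoid S n) (allFuns xs n)
  allFuns-enumerates _∈xs zero    f = here (λ ())
  allFuns-enumerates {xs} _∈xs (suc n) f =
    ≡.subst (_∈_ (Pointwise.setoid S (suc n)) f) (≡.sym (concatMap≡cartesianProductWith _ xs _))
      (∈-resp-≈ (Pointwise.setoid S (suc n)) (λ { zero → ≈-refl ; (suc i) → ≈-refl })
        (∈-cartesianProductWith⁺ S (Pointwise.setoid S n) (Pointwise.setoid S (suc n))
          (λ { x≈y f≈g zero → x≈y ; x≈y f≈g (suc i) → f≈g i })
          (f zero ∈xs) (allFuns-enumerates _∈xs n (λ i → f (suc i)))))

frac-mono : ∀ a b c d → 0 ℕ.< b → 0 ℕ.< d → a ℕ.* d ℕ.≤ c ℕ.* b → frac a b ≤ℚ frac c d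
frac-mono a (suc b) c (suc d) _ _ ad≤cb =
  ℚ.toℚᵘ-cancel-≤ (ℚᵘ.≤-respˡ-≃ (ℚᵘ.≃-sym (ℚ.toℚᵘ-fromℚᵘ (ℚᵘ.mkℚᵘ (ℤ.+ a) b)))
                    (ℚᵘ.≤-respʳ-≃ (ℚᵘ.≃-sym (ℚ.toℚᵘ-fromℚᵘ (ℚᵘ.mkℚᵘ (ℤ.+ c) d)))
                      (ℚᵘ.*≤* (≡.subst₂ ℤ._≤_ (ℤ.pos-* a (suc d)) (ℤ.pos-* c (suc b)) (ℤ.+≤+ ad≤cb)))))

frac-zero : ∀ n → frac 0 n ≡ 0ℚ
frac-zero zero    = refl
frac-zero (suc n) = ℚ.0/n≡0 (suc n)

frac-nonNeg : ∀ a b → 0ℚ ≤ℚ frac a b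
frac-nonNeg a zero    = ℚ.≤-refl
frac-nonNeg a (suc b) = frac-mono 0 1 a (suc b) (s≤s z≤n) (s≤s z≤n) z≤n

frac≤1 : ∀ a b → a ℕ.≤ b → frac a b ≤ℚ 1ℚ
frac≤1 a zero    _   = frac-nonNeg 1 1
frac≤1 a (suc b) a≤b = frac-mono a (suc b) 1 1 (s≤s z≤n) (s≤s z≤n)
  (≡.subst₂ ℕ._≤_ (≡.sym (ℕ.*-identityʳ a)) (≡.sym (ℕ.+-identityʳ (suc b))) a≤b)

p≤q⇒p≤r+q : ∀ {p q r} → 0ℚ ≤ℚ r → p ≤ℚ q → p ≤ℚ r +ℚ q
p≤q⇒p≤r+q {p} 0≤r p≤q = ≡.subst (_≤ℚ _) (ℚ.+-identityˡ p) (ℚ.+-mono-≤ 0≤r p≤q)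

p≤q⇒p≤q+r : ∀ {p q r} → 0ℚ ≤ℚ r → p ≤ℚ q → p ≤ℚ q +ℚ r
p≤q⇒p≤q+r {p} 0≤r p≤q = ≡.subst (_≤ℚ _) (ℚ.+-identityʳ p) (ℚ.+-mono-≤ p≤q 0≤r)

module _ {A : Set} (xs : List A) {P : A → Set} (P? : ∀ x → Dec (P x)) where

  𝔼≤1 : 𝔼 xs P? ≤ℚ 1ℚ
  𝔼≤1 = frac≤1 _ _ (length-filter P? xs)

  𝔼-none : (∀ x → ¬ P x) → 𝔼 xs P? ≡ 0ℚ
  𝔼-none ¬P = begin
    frac (length (filter P? xs)) (length xs)
      ≡⟨ ≡.cong (λ ys → frac (length ys) (length xs)) (filter-none P? (All.tabulate {xs = xs} λ {x} _ → ¬P x)) ⟩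
    frac 0 (length xs)
      ≡⟨ frac-zero (length xs) ⟩
    0ℚ
      ∎
    where open ≡.≡-Reasoning

  minInd-nonNeg : 0ℚ ≤ℚ minInd xs P?
  minInd-nonNeg with All.all? P? xs
  ... | yes _ = frac-nonNeg 1 1
  ... | no  _ = ℚ.≤-refl

  𝔼≤minInd : ∀ {Q : A → Set} (Q? : ∀ x → Dec (Q x)) → (∀ {x y} → P x → Q y) → 𝔼 xs P? ≤ℚ minInd xs Q?
  𝔼≤minInd Q? P⇒Q with All.all? Q? xs
  ... | yes _   = 𝔼≤1
  ... | no ¬all = ℚ.≤-reflexive (𝔼-none λ x Px → ¬all (All.tabulate λ _ → P⇒Q Px))

↑-cases : ∀ {k m p} {P : Fin (k ℕ.+ m) → Set p} →
  (∀ i → P (i ↑ˡ m)) → (∀ j → P (k ↑ʳ j)) → ∀ r → P r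
↑-cases {k} {m} {P = P} P↑ˡ P↑ʳ r = ≡.subst P (join-splitAt k m r) (cases (splitAt k r))
  where
  cases : ∀ s → P (join k m s)
  cases (inj₁ i) = P↑ˡ i
  cases (inj₂ j) = P↑ʳ j

agree-off-punchIn : ∀ {n} {A : Set} (a : Fin (suc n)) {f g : Fin (suc n) → A} →
  (∀ j → f (punchIn a j) ≡ g (punchIn a j)) → ∀ t → t ≢ a → f t ≡ g t
agree-off-punchIn a {f} {g} f≗g t t≢a =
  ≡.subst (λ t → f t ≡ g t) (punchIn-punchOut a≢t) (f≗g (punchOut a≢t))
  where a≢t = λ a≡t → t≢a (≡.sym a≡t)

m*n+[n+1+m]≡[1+m]*[1+n] : ∀ m n → m ℕ.* n ℕ.+ (n ℕ.+ suc m) ≡ suc m ℕ.* suc n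
m*n+[n+1+m]≡[1+m]*[1+n] = solve-∀

module FieldMatrices (F : FiniteField) where
  open FiniteField F using (Carrier; isCommutativeRing; inverse; _≟_; elements; complete; unique; card)
  open Matrices F

  commutativeRing : CommutativeRing 0ℓ 0ℓ
  commutativeRing = record { isCommutativeRing = isCommutativeRing }

  open CommutativeRing commutativeRing
    using ( _+_; _*_; -_; 0#; 1#; +-identityˡ; +-identityʳ; +-assoc; *-identityˡ; *-identityʳ; *-assoc
          ; *-comm; distribˡ; distribʳ; zeroˡ; zeroʳ; ring; +-commutativeMonoid; +-commutativeSemigroup)
  open RingProperties ring using (-0#≈0#; -‿+-comm; -‿distribˡ-*; +-cancelˡ; +-cancelʳ; //-rightDividesˡ)
  open CommutativeSemigroupProperties +-commutativeSemigroup using (xy∙z≈xz∙y)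
  open MonoidSum +-commutativeMonoid using (sum; sum-cong-≗; sum-replicate-zero; sum-remove; ∑-distrib-+)
  open ≡.≡-Reasoning

  IsZero : ∀ {a b} → (Fin a → Fin b → Carrier) → Set
  IsZero B = ∀ i j → B i j ≡ 0#

  IsZero-constant : ∀ {A : Set} {a b} {N : A → Fin a → Fin b → Carrier} {N₀ : Fin a → Fin b → Carrier} →
    (∀ X i j → N X i j ≡ N₀ i j) → ∀ {X Y} → IsZero (N X) → IsZero (N Y)
  IsZero-constant N≡N₀ {X} {Y} NX≡0 i j = ≡.trans (N≡N₀ Y i j) (≡.trans (≡.sym (N≡N₀ X i j)) (NX≡0 i j))

  nonzero-entry : ∀ {a b} {N : Fin a → Fin b → Carrier} → ¬ IsZero N → ∃₂ λ i j → N i j ≢ 0#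
  nonzero-entry {a} {b} {N} N≢0 with ¬∀⟶∃¬ a _ (λ i → all? λ j → N i j ≟ 0#) N≢0
  ... | i , Nᵢ≢0 with ¬∀⟶∃¬ b _ (λ j → N i j ≟ 0#) Nᵢ≢0
  ... | j , Nᵢⱼ≢0 = i , j , Nᵢⱼ≢0

  MatrixSetoid : ℕ → ℕ → Setoid 0ℓ 0ℓ
  MatrixSetoid a b = Pointwise.setoid (Pointwise.setoid (≡.setoid Carrier) b) a

  allMatrices : ∀ a b → List (Fin a → Fin b → Carrier)
  allMatrices a b = allFuns (allFuns elements b) a

  allMatrices-unique : ∀ a b → Unique (MatrixSetoid a b) (allMatrices a b)
  allMatrices-unique a b =
    allFuns-unique (Pointwise.setoid (≡.setoid Carrier) b) (allFuns-unique (≡.setoid Carrier) unique b) a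

  allMatrices-enumerates : ∀ a b → IsEnumeration (MatrixSetoid a b) (allMatrices a b)
  allMatrices-enumerates a b =
    allFuns-enumerates (Pointwise.setoid (≡.setoid Carrier) b) (allFuns-enumerates (≡.setoid Carrier) complete b) a

  length-allMatrices : ∀ a b → length (allMatrices a b) ≡ card ^ (b ℕ.* a)
  length-allMatrices a b = begin
    length (allMatrices a b)         ≡⟨ length-allFuns (allFuns elements b) a ⟩
    length (allFuns elements b) ^ a  ≡⟨ ≡.cong (_^ a) (length-allFuns elements b) ⟩
    (card ^ b) ^ a                   ≡⟨ ℕ.^-*-assoc card b a ⟩
    card ^ (b ℕ.* a)                 ∎

  instance
    card≢0 : ℕ.NonZero card
    card≢0 = ℕ.>-nonZero (∈-length (complete 0#))

  *-cancelˡ-nonZero : ∀ {c x y} → c ≢ 0# → c * x ≡ c * y → x ≡ y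
  *-cancelˡ-nonZero {c} {x} {y} c≢0 cx≡cy with inverse c c≢0
  ... | c⁻¹ , cc⁻¹≡1 = begin
    x              ≡⟨ ≡.sym (*-identityˡ x) ⟩
    1# * x         ≡⟨ ≡.cong (_* x) (≡.trans (≡.sym cc⁻¹≡1) (*-comm c c⁻¹)) ⟩
    c⁻¹ * c * x    ≡⟨ *-assoc c⁻¹ c x ⟩
    c⁻¹ * (c * x)  ≡⟨ ≡.cong (c⁻¹ *_) cx≡cy ⟩
    c⁻¹ * (c * y)  ≡⟨ ≡.sym (*-assoc c⁻¹ c y) ⟩
    c⁻¹ * c * y    ≡⟨ ≡.cong (_* y) (≡.trans (*-comm c⁻¹ c) cc⁻¹≡1) ⟩
    1# * y         ≡⟨ *-identityˡ y ⟩
    y              ∎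

  sumF≡sum : ∀ {n} (f : Fin n → Carrier) → sumF f ≡ sum f
  sumF≡sum {zero}  f = refl
  sumF≡sum {suc n} f = ≡.cong (f zero +_) (sumF≡sum (λ i → f (suc i)))

  ⊗-sum : ∀ {n} (A B : Mat n) i j → (A ⊗ B) i j ≡ sum (λ l → A i l * B l j)
  ⊗-sum A B i j = sumF≡sum (λ l → A i l * B l j)

  sum-zero : ∀ {n} {f : Fin n → Carrier} → (∀ i → f i ≡ 0#) → sum f ≡ 0#
  sum-zero {n} f≗0 = ≡.trans (sum-cong-≗ f≗0) (sum-replicate-zero n)

  sum-*-zeroˡ : ∀ {n} {f g : Fin n → Carrier} → (∀ i → f i ≡ 0#) → sum (λ i → f i * g i) ≡ 0#
  sum-*-zeroˡ {g = g} f≗0 = sum-zero λ i → ≡.trans (≡.cong (_* g i) (f≗0 i)) (zeroˡ (g i))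

  sum-*-zeroʳ : ∀ {n} {f g : Fin n → Carrier} → (∀ i → g i ≡ 0#) → sum (λ i → f i * g i) ≡ 0#
  sum-*-zeroʳ {f = f} g≗0 = sum-zero λ i → ≡.trans (≡.cong (f i *_) (g≗0 i)) (zeroʳ (f i))

  sum-neg : ∀ {n} (f : Fin n → Carrier) → sum (λ i → - f i) ≡ - sum f
  sum-neg {zero}  f = ≡.sym -0#≈0#
  sum-neg {suc n} f = ≡.trans (≡.cong (- f zero +_) (sum-neg (λ i → f (suc i)))) (-‿+-comm _ _)

  sum-↑ : ∀ k m (f : Fin (k ℕ.+ m) → Carrier) →
    sum f ≡ sum (λ i → f (i ↑ˡ m)) + sum (λ j → f (k ↑ʳ j))
  sum-↑ zero    m f = ≡.sym (+-identityˡ (sum f))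
  sum-↑ (suc k) m f = ≡.trans (≡.cong (f zero +_) (sum-↑ k m (λ i → f (suc i)))) (≡.sym (+-assoc _ _ _))

  sum-single : ∀ {n} (r : Fin n) {f : Fin n → Carrier} → (∀ l → l ≢ r → f l ≡ 0#) → sum f ≡ f r
  sum-single {suc n} r {f} f≗0 = begin
    sum f                              ≡⟨ sum-remove f ⟩
    f r + sum (λ l → f (punchIn r l))  ≡⟨ ≡.cong (f r +_) (sum-zero λ l → f≗0 (punchIn r l) (punchInᵢ≢i r l)) ⟩
    f r + 0#                           ≡⟨ +-identityʳ (f r) ⟩
    f r                                ∎

  𝟙-diagonal : ∀ {n} (i : Fin n) → 𝟙 i i ≡ 1#
  𝟙-diagonal i with i Fin.≟ i
  ... | yes _   = refl
  ... | no  i≢i = ⊥-elim (i≢i refl)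

  𝟙-offDiagonal : ∀ {n} {i j : Fin n} → i ≢ j → 𝟙 i j ≡ 0#
  𝟙-offDiagonal {i = i} {j} i≢j with i Fin.≟ j
  ... | yes i≡j = ⊥-elim (i≢j i≡j)
  ... | no  _   = refl

  𝟙-row-sum : ∀ {n} (r : Fin n) (v : Fin n → Carrier) → sum (λ l → 𝟙 r l * v l) ≡ v r
  𝟙-row-sum r v = begin
    sum (λ l → 𝟙 r l * v l)  ≡⟨ sum-single r (λ l l≢r → ≡.trans (≡.cong (_* v l) (𝟙-offDiagonal (l≢r ∘ ≡.sym)))
                                                                 (zeroˡ (v l))) ⟩
    𝟙 r r * v r              ≡⟨ ≡.cong (_* v r) (𝟙-diagonal r) ⟩
    1# * v r                 ≡⟨ *-identityˡ (v r) ⟩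
    v r                      ∎

  𝟙-col-sum : ∀ {n} (c : Fin n) (v : Fin n → Carrier) → sum (λ l → v l * 𝟙 l c) ≡ v c
  𝟙-col-sum c v = begin
    sum (λ l → v l * 𝟙 l c)  ≡⟨ sum-single c (λ l l≢c → ≡.trans (≡.cong (v l *_) (𝟙-offDiagonal l≢c)) (zeroʳ (v l))) ⟩
    v c * 𝟙 c c              ≡⟨ ≡.cong (v c *_) (𝟙-diagonal c) ⟩
    v c * 1#                 ≡⟨ *-identityʳ (v c) ⟩
    v c                      ∎

  𝟙+-⊗ : ∀ {n} (r : Fin n) (e v : Fin n → Carrier) →
    sum (λ l → (𝟙 r l + e l) * v l) ≡ v r + sum (λ l → e l * v l)
  𝟙+-⊗ r e v = begin
    sum (λ l → (𝟙 r l + e l) * v l)                  ≡⟨ sum-cong-≗ (λ l → distribʳ (v l) (𝟙 r l) (e l)) ⟩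
    sum (λ l → 𝟙 r l * v l + e l * v l)              ≡⟨ ∑-distrib-+ (λ l → 𝟙 r l * v l) (λ l → e l * v l) ⟩
    sum (λ l → 𝟙 r l * v l) + sum (λ l → e l * v l)  ≡⟨ ≡.cong (_+ sum (λ l → e l * v l)) (𝟙-row-sum r v) ⟩
    v r + sum (λ l → e l * v l)                      ∎

  ⊗-𝟙+ : ∀ {n} (c : Fin n) (e v : Fin n → Carrier) →
    sum (λ l → v l * (𝟙 l c + e l)) ≡ v c + sum (λ l → v l * e l)
  ⊗-𝟙+ c e v = begin
    sum (λ l → v l * (𝟙 l c + e l))                  ≡⟨ sum-cong-≗ (λ l → distribˡ (v l) (𝟙 l c) (e l)) ⟩
    sum (λ l → v l * 𝟙 l c + v l * e l)              ≡⟨ ∑-distrib-+ (λ l → v l * 𝟙 l c) (λ l → v l * e l) ⟩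
    sum (λ l → v l * 𝟙 l c) + sum (λ l → v l * e l)  ≡⟨ ≡.cong (_+ sum (λ l → v l * e l)) (𝟙-col-sum c v) ⟩
    v c + sum (λ l → v l * e l)                      ∎

  sum-determines : ∀ {n} (c x y : Fin n → Carrier) (b : Fin n) → c b ≢ 0# → (∀ s → s ≢ b → x s ≡ y s) →
    sum (λ s → c s * x s) ≡ sum (λ s → c s * y s) → x b ≡ y b
  sum-determines {suc n} c x y b cb≢0 x≗y cx≡cy = *-cancelˡ-nonZero cb≢0 (+-cancelʳ (rest x) _ _ (begin
    c b * x b + rest x     ≡⟨ sum-remove {i = b} (λ s → c s * x s) ⟨
    sum (λ s → c s * x s)  ≡⟨ cx≡cy ⟩
    sum (λ s → c s * y s)  ≡⟨ sum-remove {i = b} (λ s → c s * y s) ⟩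
    c b * y b + rest y     ≡⟨ ≡.cong (c b * y b +_) (sum-cong-≗ λ s →
                                ≡.cong (c (punchIn b s) *_) (x≗y (punchIn b s) (punchInᵢ≢i b s))) ⟨
    c b * y b + rest x     ∎))
    where
    rest : (Fin (suc n) → Carrier) → Carrier
    rest z = sum (λ s → c (punchIn b s) * z (punchIn b s))

  sum-determinesʳ : ∀ {n} (c x y : Fin n → Carrier) (b : Fin n) → c b ≢ 0# → (∀ s → s ≢ b → x s ≡ y s) →
    sum (λ s → x s * c s) ≡ sum (λ s → y s * c s) → x b ≡ y b
  sum-determinesʳ c x y b cb≢0 x≗y xc≡yc = sum-determines c x y b cb≢0 x≗y (begin
    sum (λ s → c s * x s)  ≡⟨ sum-cong-≗ (λ s → *-comm (c s) (x s)) ⟩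
    sum (λ s → x s * c s)  ≡⟨ xc≡yc ⟩
    sum (λ s → y s * c s)  ≡⟨ sum-cong-≗ (λ s → *-comm (y s) (c s)) ⟩
    sum (λ s → c s * y s)  ∎)

  module _ {k m} (C : Fin m → Fin k → Carrier) {a b} (Cab≢0 : C a b ≢ 0#) {X Y : Fin k → Fin m → Carrier} where

    determined-off-column : (∀ i → sum (λ t → X i t * C t b) ≡ sum (λ t → Y i t * C t b)) →
      (∀ i t → t ≢ a → X i t ≡ Y i t) → ∀ i t → X i t ≡ Y i t
    determined-off-column XC≡YC X≗Y i t with t Fin.≟ a
    ... | yes refl = sum-determinesʳ (λ s → C s b) (X i) (Y i) a Cab≢0 (X≗Y i) (XC≡YC i)
    ... | no  t≢a  = X≗Y i t t≢a

    determined-off-row-and-column : (∀ j → sum (λ s → C a s * X s j) ≡ sum (λ s → C a s * Y s j)) →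
      (∀ i → sum (λ t → X i t * C t b) ≡ sum (λ t → Y i t * C t b)) →
      (∀ i t → i ≢ b → t ≢ a → X i t ≡ Y i t) → ∀ i t → X i t ≡ Y i t
    determined-off-row-and-column CX≡CY XC≡YC X≗Y = determined-off-column XC≡YC off-column
      where
      off-column : ∀ i t → t ≢ a → X i t ≡ Y i t
      off-column i t t≢a with i Fin.≟ b
      ... | yes refl = sum-determines (C a) (λ s → X s t) (λ s → Y s t) b Cab≢0
                         (λ s s≢b → X≗Y s t s≢b t≢a) (CX≡CY t)
      ... | no  i≢b  = X≗Y i t i≢b t≢a

  module BlockAlgebra (k m : ℕ) where
    open Blocks k m

    Block : Set
    Block = Fin k → Fin m → Carrier

    embedE-↑ˡ↑ʳ : ∀ (X : Block) i j → embedE X (i ↑ˡ m) (k ↑ʳ j) ≡ X i j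
    embedE-↑ˡ↑ʳ X i j rewrite splitAt-↑ˡ k i m | splitAt-↑ʳ k m j = refl

    embedE-col-↑ˡ : ∀ (X : Block) r j → embedE X r (j ↑ˡ m) ≡ 0#
    embedE-col-↑ˡ X r j rewrite splitAt-↑ˡ k j m with splitAt k r
    ... | inj₁ _ = refl
    ... | inj₂ _ = refl

    embedE-row-↑ʳ : ∀ (X : Block) i c → embedE X (k ↑ʳ i) c ≡ 0#
    embedE-row-↑ʳ X i c rewrite splitAt-↑ʳ k m i with splitAt k c
    ... | inj₁ _ = refl
    ... | inj₂ _ = refl

    embedE-row-↑ˡ-sum : ∀ (X : Block) i (v : Fin (k ℕ.+ m) → Carrier) →
      sum (λ l → embedE X (i ↑ˡ m) l * v l) ≡ sum (λ t → X i t * v (k ↑ʳ t))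
    embedE-row-↑ˡ-sum X i v = begin
      sum (λ l → embedE X (i ↑ˡ m) l * v l)
        ≡⟨ sum-↑ k m _ ⟩
      sum (λ s → embedE X (i ↑ˡ m) (s ↑ˡ m) * v (s ↑ˡ m))
        + sum (λ t → embedE X (i ↑ˡ m) (k ↑ʳ t) * v (k ↑ʳ t))
        ≡⟨ ≡.cong₂ _+_ (sum-*-zeroˡ λ s → embedE-col-↑ˡ X _ s)
                       (sum-cong-≗ λ t → ≡.cong (_* v (k ↑ʳ t)) (embedE-↑ˡ↑ʳ X i t)) ⟩
      0# + sum (λ t → X i t * v (k ↑ʳ t))
        ≡⟨ +-identityˡ _ ⟩
      sum (λ t → X i t * v (k ↑ʳ t))
        ∎

    embedE-col-↑ʳ-sum : ∀ (X : Block) j (v : Fin (k ℕ.+ m) → Carrier) →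
      sum (λ l → v l * embedE X l (k ↑ʳ j)) ≡ sum (λ s → v (s ↑ˡ m) * X s j)
    embedE-col-↑ʳ-sum X j v = begin
      sum (λ l → v l * embedE X l (k ↑ʳ j))
        ≡⟨ sum-↑ k m _ ⟩
      sum (λ s → v (s ↑ˡ m) * embedE X (s ↑ˡ m) (k ↑ʳ j))
        + sum (λ t → v (k ↑ʳ t) * embedE X (k ↑ʳ t) (k ↑ʳ j))
        ≡⟨ ≡.cong₂ _+_ (sum-cong-≗ λ s → ≡.cong (v (s ↑ˡ m) *_) (embedE-↑ˡ↑ʳ X s j))
                       (sum-*-zeroʳ λ t → embedE-row-↑ʳ X t _) ⟩
      sum (λ s → v (s ↑ˡ m) * X s j) + 0#
        ≡⟨ +-identityʳ _ ⟩
      sum (λ s → v (s ↑ˡ m) * X s j)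
        ∎

    hInvOf⊗ : ∀ (X : Block) (N : Mat (k ℕ.+ m)) r c →
      (hInvOf X ⊗ N) r c ≡ N r c + - sum (λ l → embedE X r l * N l c)
    hInvOf⊗ X N r c = begin
      (hInvOf X ⊗ N) r c
        ≡⟨ ⊗-sum (hInvOf X) N r c ⟩
      sum (λ l → (𝟙 r l + - embedE X r l) * N l c)
        ≡⟨ 𝟙+-⊗ r _ _ ⟩
      N r c + sum (λ l → - embedE X r l * N l c)
        ≡⟨ ≡.cong (N r c +_) (sum-cong-≗ λ l → -‿distribˡ-* (embedE X r l) (N l c)) ⟨
      N r c + sum (λ l → - (embedE X r l * N l c))
        ≡⟨ ≡.cong (N r c +_) (sum-neg (λ l → embedE X r l * N l c)) ⟩
      N r c + - sum (λ l → embedE X r l * N l c)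
        ∎

    hInvOf⊗-↑ʳ : ∀ (X : Block) (N : Mat (k ℕ.+ m)) i c → (hInvOf X ⊗ N) (k ↑ʳ i) c ≡ N (k ↑ʳ i) c
    hInvOf⊗-↑ʳ X N i c = begin
      (hInvOf X ⊗ N) (k ↑ʳ i) c
        ≡⟨ hInvOf⊗ X N _ c ⟩
      N (k ↑ʳ i) c + - sum (λ l → embedE X (k ↑ʳ i) l * N l c)
        ≡⟨ ≡.cong (λ z → N (k ↑ʳ i) c + - z) (sum-*-zeroˡ (embedE-row-↑ʳ X i)) ⟩
      N (k ↑ʳ i) c + - 0#
        ≡⟨ ≡.cong (N (k ↑ʳ i) c +_) -0#≈0# ⟩
      N (k ↑ʳ i) c + 0#
        ≡⟨ +-identityʳ _ ⟩
      N (k ↑ʳ i) c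
        ∎

    hInvOf⊗-↑ˡ : ∀ (X : Block) (N : Mat (k ℕ.+ m)) i c →
      (hInvOf X ⊗ N) (i ↑ˡ m) c + sum (λ t → X i t * N (k ↑ʳ t) c) ≡ N (i ↑ˡ m) c
    hInvOf⊗-↑ˡ X N i c = begin
      (hInvOf X ⊗ N) (i ↑ˡ m) c + S
        ≡⟨ ≡.cong (_+ S) (hInvOf⊗ X N _ c) ⟩
      N (i ↑ˡ m) c + - sum (λ l → embedE X (i ↑ˡ m) l * N l c) + S
        ≡⟨ ≡.cong (λ z → N (i ↑ˡ m) c + - z + S) (embedE-row-↑ˡ-sum X i (λ l → N l c)) ⟩
      N (i ↑ˡ m) c + - S + S
        ≡⟨ //-rightDividesˡ S _ ⟩
      N (i ↑ˡ m) c
        ∎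
      where S = sum (λ t → X i t * N (k ↑ʳ t) c)

    ⊗hOf : ∀ (X : Block) (N : Mat (k ℕ.+ m)) r c → (N ⊗ hOf X) r c ≡ N r c + sum (λ l → N r l * embedE X l c)
    ⊗hOf X N r c = ≡.trans (⊗-sum N (hOf X) r c) (⊗-𝟙+ c _ _)

    ⊗hOf-↑ˡ : ∀ (X : Block) (N : Mat (k ℕ.+ m)) r j → (N ⊗ hOf X) r (j ↑ˡ m) ≡ N r (j ↑ˡ m)
    ⊗hOf-↑ˡ X N r j = begin
      (N ⊗ hOf X) r (j ↑ˡ m)
        ≡⟨ ⊗hOf X N r _ ⟩
      N r (j ↑ˡ m) + sum (λ l → N r l * embedE X l (j ↑ˡ m))
        ≡⟨ ≡.cong (N r (j ↑ˡ m) +_) (sum-*-zeroʳ λ l → embedE-col-↑ˡ X l j) ⟩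
      N r (j ↑ˡ m) + 0#
        ≡⟨ +-identityʳ _ ⟩
      N r (j ↑ˡ m)
        ∎

    ⊗hOf-↑ʳ : ∀ (X : Block) (N : Mat (k ℕ.+ m)) r j →
      (N ⊗ hOf X) r (k ↑ʳ j) ≡ N r (k ↑ʳ j) + sum (λ s → N r (s ↑ˡ m) * X s j)
    ⊗hOf-↑ʳ X N r j = ≡.trans (⊗hOf X N r _) (≡.cong (N r (k ↑ʳ j) +_) (embedE-col-↑ʳ-sum X j (N r)))

    length-filter≤-by-injection : ∀ {a b} {P : Block → Set} (P? : ∀ X → Dec (P X))
      (r : Block → Fin a → Fin b → Carrier) →
      (∀ {X Y} → P X → P Y → (∀ i j → r X i j ≡ r Y i j) → ∀ i j → X i j ≡ Y i j) →
      length (filter P? allBlocks) ℕ.≤ card ^ (b ℕ.* a)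
    length-filter≤-by-injection {a} {b} P? r r-injective =
      ≡.subst (length (filter P? allBlocks) ℕ.≤_) (length-allMatrices a b)
        (injectiveOn⇒length≤ (MatrixSetoid k m) (MatrixSetoid a b) r r-injective
          (filter⁺ (MatrixSetoid k m) P? (allMatrices-unique k m)) (all-filter P? allBlocks)
          (allMatrices-enumerates a b))

    𝔼≤1/q^ : ∀ {P : Block → Set} (P? : ∀ X → Dec (P X)) e₁ e₂ → e₁ ℕ.+ e₂ ≡ m ℕ.* k →
      length (filter P? allBlocks) ℕ.≤ card ^ e₁ → 𝔼 allBlocks P? ≤ℚ frac 1 (card ^ e₂)
    𝔼≤1/q^ P? e₁ e₂ e₁+e₂≡mk count≤ = frac-mono _ _ 1 (card ^ e₂)
      (≡.subst (0 ℕ.<_) (≡.sym (length-allMatrices k m)) (ℕ.m^n>0 card (m ℕ.* k))) (ℕ.m^n>0 card e₂)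
      (ℕ.≤-trans (ℕ.*-monoˡ-≤ (card ^ e₂) count≤) (ℕ.≤-reflexive q^e₁*q^e₂≡total))
      where
      q^e₁*q^e₂≡total : card ^ e₁ ℕ.* card ^ e₂ ≡ 1 ℕ.* length allBlocks
      q^e₁*q^e₂≡total = begin
        card ^ e₁ ℕ.* card ^ e₂   ≡⟨ ℕ.^-distribˡ-+-* card e₁ e₂ ⟨
        card ^ (e₁ ℕ.+ e₂)        ≡⟨ ≡.cong (card ^_) e₁+e₂≡mk ⟩
        card ^ (m ℕ.* k)          ≡⟨ length-allMatrices k m ⟨
        length allBlocks          ≡⟨ ℕ.*-identityˡ _ ⟨
        1 ℕ.* length allBlocks    ∎

    blocks-zero⇒zero : ∀ {N : Mat (k ℕ.+ m)} →
      IsZero (p₁₁ N) → IsZero (p₁₂ N) → IsZero (p₂₁ N) → IsZero (p₂₂ N) → IsZero N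
    blocks-zero⇒zero N₁₁≡0 N₁₂≡0 N₂₁≡0 N₂₂≡0 =
      ↑-cases (λ i → ↑-cases (N₁₁≡0 i) (N₁₂≡0 i)) (λ i → ↑-cases (N₂₁≡0 i) (N₂₂≡0 i))

    module _ (M : Mat (k ℕ.+ m)) where

      p₂₁-conj : ∀ X i j → p₂₁ (conj M X) i j ≡ p₂₁ M i j
      p₂₁-conj X i j = ≡.trans (⊗hOf-↑ˡ X (hInvOf X ⊗ M) (k ↑ʳ i) j) (hInvOf⊗-↑ʳ X M i (j ↑ˡ m))

      p₁₁-conj : ∀ X i j → p₁₁ (conj M X) i j + sum (λ t → X i t * p₂₁ M t j) ≡ p₁₁ M i j
      p₁₁-conj X i j =
        ≡.trans (≡.cong (_+ sum (λ t → X i t * p₂₁ M t j)) (⊗hOf-↑ˡ X (hInvOf X ⊗ M) (i ↑ˡ m) j))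
                (hInvOf⊗-↑ˡ X M i (j ↑ˡ m))

      p₂₂-conj : ∀ X i j → p₂₂ (conj M X) i j ≡ p₂₂ M i j + sum (λ s → p₂₁ M i s * X s j)
      p₂₂-conj X i j = ≡.trans (⊗hOf-↑ʳ X (hInvOf X ⊗ M) (k ↑ʳ i) j)
        (≡.cong₂ _+_ (hInvOf⊗-↑ʳ X M i (k ↑ʳ j)) (sum-cong-≗ λ s → ≡.cong (_* X s j) (hInvOf⊗-↑ʳ X M i (s ↑ˡ m))))

      p₁₂-conj : ∀ X i j →
        p₁₂ (conj M X) i j + sum (λ t → X i t * p₂₂ M t j) ≡ p₁₂ M i j + sum (λ s → p₁₁ (conj M X) i s * X s j)
      p₁₂-conj X i j = begin
        p₁₂ (conj M X) i j + XD
          ≡⟨ ≡.cong (_+ XD) (⊗hOf-↑ʳ X G (i ↑ˡ m) j) ⟩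
        G (i ↑ˡ m) (k ↑ʳ j) + sum (λ s → G (i ↑ˡ m) (s ↑ˡ m) * X s j) + XD
          ≡⟨ xy∙z≈xz∙y _ _ XD ⟩
        G (i ↑ˡ m) (k ↑ʳ j) + XD + sum (λ s → G (i ↑ˡ m) (s ↑ˡ m) * X s j)
          ≡⟨ ≡.cong₂ _+_ (hInvOf⊗-↑ˡ X M i (k ↑ʳ j))
                         (sum-cong-≗ λ s → ≡.cong (_* X s j) (≡.sym (⊗hOf-↑ˡ X G (i ↑ˡ m) s))) ⟩
        p₁₂ M i j + sum (λ s → p₁₁ (conj M X) i s * X s j)
          ∎
        where
        G  = hInvOf X ⊗ M
        XD = sum (λ t → X i t * p₂₂ M t j)

      p₁₁-conj≡0⇒X*p₂₁≡p₁₁ : ∀ {X} → IsZero (p₁₁ (conj M X)) →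
        ∀ i j → sum (λ t → X i t * p₂₁ M t j) ≡ p₁₁ M i j
      p₁₁-conj≡0⇒X*p₂₁≡p₁₁ {X} p₁₁≡0 i j = begin
        XC                       ≡⟨ +-identityˡ XC ⟨
        0# + XC                  ≡⟨ ≡.cong (_+ XC) (p₁₁≡0 i j) ⟨
        p₁₁ (conj M X) i j + XC  ≡⟨ p₁₁-conj X i j ⟩
        p₁₁ M i j                ∎
        where XC = sum (λ t → X i t * p₂₁ M t j)

      p₁₁-conj≡0⇒X*p₂₁≡Y*p₂₁ : ∀ {X Y} → IsZero (p₁₁ (conj M X)) → IsZero (p₁₁ (conj M Y)) →
        ∀ i j → sum (λ t → X i t * p₂₁ M t j) ≡ sum (λ t → Y i t * p₂₁ M t j)
      p₁₁-conj≡0⇒X*p₂₁≡Y*p₂₁ X₁₁≡0 Y₁₁≡0 i j =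
        ≡.trans (p₁₁-conj≡0⇒X*p₂₁≡p₁₁ X₁₁≡0 i j) (≡.sym (p₁₁-conj≡0⇒X*p₂₁≡p₁₁ Y₁₁≡0 i j))

      p₂₂-conj≡0⇒p₂₁*X≡p₂₁*Y : ∀ {X Y} → IsZero (p₂₂ (conj M X)) → IsZero (p₂₂ (conj M Y)) →
        ∀ i j → sum (λ s → p₂₁ M i s * X s j) ≡ sum (λ s → p₂₁ M i s * Y s j)
      p₂₂-conj≡0⇒p₂₁*X≡p₂₁*Y {X} {Y} X₂₂≡0 Y₂₂≡0 i j = +-cancelˡ (p₂₂ M i j) _ _ (begin
        p₂₂ M i j + sum (λ s → p₂₁ M i s * X s j)  ≡⟨ p₂₂-conj X i j ⟨
        p₂₂ (conj M X) i j                         ≡⟨ ≡.trans (X₂₂≡0 i j) (≡.sym (Y₂₂≡0 i j)) ⟩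
        p₂₂ (conj M Y) i j                         ≡⟨ p₂₂-conj Y i j ⟩
        p₂₂ M i j + sum (λ s → p₂₁ M i s * Y s j)  ∎)

      p₂₁≡0⇒p₁₁-conj≡p₁₁ : IsZero (p₂₁ M) → ∀ X i j → p₁₁ (conj M X) i j ≡ p₁₁ M i j
      p₂₁≡0⇒p₁₁-conj≡p₁₁ p₂₁≡0 X i j = begin
        p₁₁ (conj M X) i j                                  ≡⟨ +-identityʳ _ ⟨
        p₁₁ (conj M X) i j + 0#                             ≡⟨ ≡.cong (p₁₁ (conj M X) i j +_)
                                                                      (sum-*-zeroʳ λ t → p₂₁≡0 t j) ⟨
        p₁₁ (conj M X) i j + sum (λ t → X i t * p₂₁ M t j)  ≡⟨ p₁₁-conj X i j ⟩
        p₁₁ M i j                                           ∎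

      p₂₁≡0⇒p₂₂-conj≡p₂₂ : IsZero (p₂₁ M) → ∀ X i j → p₂₂ (conj M X) i j ≡ p₂₂ M i j
      p₂₁≡0⇒p₂₂-conj≡p₂₂ p₂₁≡0 X i j = begin
        p₂₂ (conj M X) i j                         ≡⟨ p₂₂-conj X i j ⟩
        p₂₂ M i j + sum (λ s → p₂₁ M i s * X s j)  ≡⟨ ≡.cong (p₂₂ M i j +_) (sum-*-zeroˡ (p₂₁≡0 i)) ⟩
        p₂₂ M i j + 0#                             ≡⟨ +-identityʳ _ ⟩
        p₂₂ M i j                                  ∎

      p₂₂≡0⇒p₁₂-conj≡p₁₂ : IsZero (p₂₂ M) → ∀ {X} → IsZero (p₁₁ (conj M X)) →
        ∀ i j → p₁₂ (conj M X) i j ≡ p₁₂ M i j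
      p₂₂≡0⇒p₁₂-conj≡p₁₂ p₂₂≡0 {X} p₁₁≡0 i j = begin
        p₁₂ (conj M X) i j                                  ≡⟨ +-identityʳ _ ⟨
        p₁₂ (conj M X) i j + 0#                             ≡⟨ ≡.cong (p₁₂ (conj M X) i j +_)
                                                                      (sum-*-zeroʳ λ t → p₂₂≡0 t j) ⟨
        p₁₂ (conj M X) i j + sum (λ t → X i t * p₂₂ M t j)  ≡⟨ p₁₂-conj X i j ⟩
        p₁₂ M i j + sum (λ s → p₁₁ (conj M X) i s * X s j)  ≡⟨ ≡.cong (p₁₂ M i j +_) (sum-*-zeroˡ (p₁₁≡0 i)) ⟩
        p₁₂ M i j + 0#                                      ≡⟨ +-identityʳ _ ⟩
        p₁₂ M i j                                           ∎

module ConjugationBy1+E (F : FiniteField) (k′ m′ : ℕ) where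
  open FiniteField F using (Carrier; card; 0#)
  open Matrices F
  open FieldMatrices F

  open Blocks (suc k′) (suc m′)
  open BlockAlgebra (suc k′) (suc m′)

  module _ (M : Mat (suc k′ ℕ.+ suc m′)) where

    conj-vanishing⇒zero : IsZero (p₂₁ M) →
      ∀ {X} → IsZero (p₁₁ (conj M X)) × IsZero (p₁₂ (conj M X)) × IsZero (p₂₂ (conj M X)) → IsZero M
    conj-vanishing⇒zero p₂₁≡0 {X} (X₁₁≡0 , X₁₂≡0 , X₂₂≡0) = blocks-zero⇒zero p₁₁≡0 p₁₂≡0 p₂₁≡0 p₂₂≡0
      where
      p₁₁≡0 : IsZero (p₁₁ M)
      p₁₁≡0 i j = ≡.trans (≡.sym (p₂₁≡0⇒p₁₁-conj≡p₁₁ M p₂₁≡0 X i j)) (X₁₁≡0 i j)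
      p₂₂≡0 : IsZero (p₂₂ M)
      p₂₂≡0 i j = ≡.trans (≡.sym (p₂₁≡0⇒p₂₂-conj≡p₂₂ M p₂₁≡0 X i j)) (X₂₂≡0 i j)
      p₁₂≡0 : IsZero (p₁₂ M)
      p₁₂≡0 i j = ≡.trans (≡.sym (p₂₂≡0⇒p₁₂-conj≡p₁₂ M p₂₂≡0 X₁₁≡0 i j)) (X₁₂≡0 i j)

    module _ {a b} (Cab≢0 : p₂₁ M a b ≢ 0#) {X Y : Block} where

      determined-by-p₁₁-conj : IsZero (p₁₁ (conj M X)) → IsZero (p₁₁ (conj M Y)) →
        (∀ i j → X i (punchIn a j) ≡ Y i (punchIn a j)) → ∀ i j → X i j ≡ Y i j
      determined-by-p₁₁-conj X₁₁≡0 Y₁₁≡0 X≗Y = determined-off-column (p₂₁ M) Cab≢0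
        (λ i → p₁₁-conj≡0⇒X*p₂₁≡Y*p₂₁ M X₁₁≡0 Y₁₁≡0 i b) (λ i → agree-off-punchIn a (X≗Y i))

      determined-by-p₁₁-p₂₂-conj : IsZero (p₁₁ (conj M X)) × IsZero (p₂₂ (conj M X)) →
        IsZero (p₁₁ (conj M Y)) × IsZero (p₂₂ (conj M Y)) →
        (∀ i j → X (punchIn b i) (punchIn a j) ≡ Y (punchIn b i) (punchIn a j)) → ∀ i j → X i j ≡ Y i j
      determined-by-p₁₁-p₂₂-conj (X₁₁≡0 , X₂₂≡0) (Y₁₁≡0 , Y₂₂≡0) X≗Y =
        determined-off-row-and-column (p₂₁ M) Cab≢0
          (p₂₂-conj≡0⇒p₂₁*X≡p₂₁*Y M X₂₂≡0 Y₂₂≡0 a) (λ i → p₁₁-conj≡0⇒X*p₂₁≡Y*p₂₁ M X₁₁≡0 Y₁₁≡0 i b)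
          (λ i t i≢b t≢a → agree-off-punchIn b (λ i′ → agree-off-punchIn a (X≗Y i′) t t≢a) i i≢b)

    part₁ : 𝔼 allBlocks (λ X → isZero (p₁₁ (conj M X)))
      ≤ℚ frac 1 (card ^ suc k′) +ℚ minInd allBlocks (λ X → isZero (p₁₁ (conj M X)) ×-dec isZero (p₂₁ (conj M X)))
    part₁ with isZero (p₂₁ M)
    ... | yes p₂₁≡0 = p≤q⇒p≤r+q (frac-nonNeg 1 (card ^ suc k′)) (𝔼≤minInd allBlocks _ _ λ X₁₁≡0 →
      IsZero-constant (p₂₁≡0⇒p₁₁-conj≡p₁₁ M p₂₁≡0) X₁₁≡0 , λ i j → ≡.trans (p₂₁-conj M _ i j) (p₂₁≡0 i j))
    ... | no p₂₁≢0 with a , b , Cab≢0 ← nonzero-entry p₂₁≢0 =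
      p≤q⇒p≤q+r (minInd-nonNeg allBlocks _) (𝔼≤1/q^ _ (m′ ℕ.* suc k′) (suc k′) (ℕ.+-comm (m′ ℕ.* suc k′) (suc k′))
        (length-filter≤-by-injection _ (λ X i j → X i (punchIn a j)) (determined-by-p₁₁-conj Cab≢0)))

    part₂ : 𝔼 allBlocks (λ X → isZero (p₁₁ (conj M X)) ×-dec isZero (p₂₂ (conj M X)))
      ≤ℚ frac 1 (card ^ (k′ ℕ.+ suc m′)) +ℚ minInd allBlocks
           (λ X → isZero (p₁₁ (conj M X)) ×-dec (isZero (p₂₁ (conj M X)) ×-dec isZero (p₂₂ (conj M X))))
    part₂ with isZero (p₂₁ M)
    ... | yes p₂₁≡0 =
      p≤q⇒p≤r+q (frac-nonNeg 1 (card ^ (k′ ℕ.+ suc m′))) (𝔼≤minInd allBlocks _ _ λ (X₁₁≡0 , X₂₂≡0) →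
        IsZero-constant (p₂₁≡0⇒p₁₁-conj≡p₁₁ M p₂₁≡0) X₁₁≡0 ,
        (λ i j → ≡.trans (p₂₁-conj M _ i j) (p₂₁≡0 i j)) ,
        IsZero-constant (p₂₁≡0⇒p₂₂-conj≡p₂₂ M p₂₁≡0) X₂₂≡0)
    ... | no p₂₁≢0 with a , b , Cab≢0 ← nonzero-entry p₂₁≢0 =
      p≤q⇒p≤q+r (minInd-nonNeg allBlocks _) (𝔼≤1/q^ _ (m′ ℕ.* k′) (k′ ℕ.+ suc m′) (m*n+[n+1+m]≡[1+m]*[1+n] m′ k′)
        (length-filter≤-by-injection _ (λ X i j → X (punchIn b i) (punchIn a j)) (determined-by-p₁₁-p₂₂-conj Cab≢0)))

    part₃ : ¬ IsZero M →
      𝔼 allBlocks (λ X → isZero (p₁₁ (conj M X)) ×-dec (isZero (p₁₂ (conj M X)) ×-dec isZero (p₂₂ (conj M X))))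
        ≤ℚ frac 1 (card ^ (k′ ℕ.+ suc m′))
    part₃ M≢0 with isZero (p₂₁ M)
    ... | yes p₂₁≡0 = ≡.subst (_≤ℚ frac 1 (card ^ (k′ ℕ.+ suc m′)))
      (≡.sym (𝔼-none allBlocks _ λ X X-vanishes → M≢0 (conj-vanishing⇒zero p₂₁≡0 X-vanishes)))
      (frac-nonNeg 1 (card ^ (k′ ℕ.+ suc m′)))
    ... | no p₂₁≢0 with a , b , Cab≢0 ← nonzero-entry p₂₁≢0 =
      𝔼≤1/q^ _ (m′ ℕ.* k′) (k′ ℕ.+ suc m′) (m*n+[n+1+m]≡[1+m]*[1+n] m′ k′)
        (length-filter≤-by-injection _ (λ X i j → X (punchIn b i) (punchIn a j))
          λ (X₁₁≡0 , _ , X₂₂≡0) (Y₁₁≡0 , _ , Y₂₂≡0) →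
            determined-by-p₁₁-p₂₂-conj Cab≢0 (X₁₁≡0 , X₂₂≡0) (Y₁₁≡0 , Y₂₂≡0))

open import Data.Nat using (ℕ; _≤_; _^_; _*_; _∸_)
open import Data.Rational using (ℚ) renaming (_≤_ to _≤ℚ_; _+_ to _+ℚ_)
open import Data.Product using (_×_)
open import Relation.Nullary using (¬_; _×-dec_)
open import Relation.Binary.PropositionalEquality using (_≡_)

lemma5p1 : (F : FiniteField) → IsPrimePower (FiniteField.card F)
    → (k m : ℕ) → 1 ≤ k → 1 ≤ m
    → let open FiniteField F
          open Matrices F
          open Blocks k m
          q = card
      in (M : Mat (Data.Nat._+_ k m)) → ¬ (∀ i j → M i j ≡ 0#)
    → (𝔼 allBlocks (λ X → isZero (p₁₁ (conj M X)))
         ≤ℚ frac 1 (q ^ k)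
            +ℚ minInd allBlocks (λ X → isZero (p₁₁ (conj M X)) ×-dec isZero (p₂₁ (conj M X))))
    × (𝔼 allBlocks (λ X → isZero (p₁₁ (conj M X)) ×-dec isZero (p₂₂ (conj M X)))
         ≤ℚ frac 1 (q ^ (Data.Nat._+_ k m ∸ 1))
            +ℚ minInd allBlocks (λ X → isZero (p₁₁ (conj M X)) ×-dec (isZero (p₂₁ (conj M X)) ×-dec isZero (p₂₂ (conj M X)))))
    × (𝔼 allBlocks (λ X → isZero (p₁₁ (conj M X)) ×-dec (isZero (p₁₂ (conj M X)) ×-dec isZero (p₂₂ (conj M X))))
         ≤ℚ frac 1 (q ^ (Data.Nat._+_ k m ∸ 1)))
lemma5p1 F _ zero     m        ()     _
lemma5p1 F _ (suc k)  zero     _      ()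
lemma5p1 F _ (suc k′) (suc m′) _      _  M M≢0 = part₁ M , part₂ M , part₃ M M≢0
  where open ConjugationBy1+E F k′ m′
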